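{- For any forward trie $\mathsf{T}_{\mathsf{f}}$ with $n$ nodes over an alphabet of size $\sigma$, the smallest deterministic finite automaton accepting $\mathit{Suffix}(\mathsf{T}_{\mathsf{f}})$ has $O(\sigma n)$ transitions. Moreover, there exist forward tries $\mathsf{T}_{\mathsf{f}}$ with $n$ nodes over an alphabet of size $\sigma$ (for $\sigma$ ranging from $\Theta(1)$ to $\Theta(n)$) for which this smallest DFA has $\Omega(\sigma n)$ transitions; in particular $\Omega(n^2)$ transitions when $\sigma=\Theta(n)$.
   Context: Let $\Sigma$ be an ordered alphabet. A forward trie $\mathsf{T}_{\mathsf{f}}$ is a rooted tree with edges labeled by single characters of $\Sigma$, the out-going edges of each node having distinct labels. For $u$ an ancestor of $v$, $\mathit{str}_{\mathsf{f}}(u,v)$ is the string spelled by the downward path from $u$ to $v$. $\mathit{Suffix}(\mathsf{T}_{\mathsf{f}})=\{\mathit{str}_{\mathsf{f}}(u,l): l \text{ a leaf}, u \text{ an ancestor of } l\}$. Convention: the root of the trie is connected to an auxiliary node $\bot$ by an edge labeled by a unique character $\$$ occurring nowhere else. -}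

module Defs where

open import Data.Nat using (ℕ; zero; suc; _+_; _≤_)
open import Data.Fin using (Fin; zero; suc)
open import Data.Maybe using (Maybe; just; nothing)
open import Data.List using (List; []; _∷_)
open import Data.Bool using (Bool; true; false)
open import Data.Product using (Σ; ∃; _×_; _,_)
open import Relation.Binary.PropositionalEquality using (_≡_)
open import Function.Bundles using (_⇔_)

sumFin : (k : ℕ) → (Fin k → ℕ) → ℕ
sumFin zero    g = 0
sumFin (suc k) g = g zero + sumFin k (λ i → g (suc i))

-- Forward tries over the alphabet Fin σ.
-- A node is given by its (partial) map from labels to children;
-- out-going edges of a node automatically have distinct labels.

data Trie (σ : ℕ) : Set where
  node : (Fin σ → Maybe (Trie σ)) → Trie σ

children : ∀ {σ} → Trie σ → Fin σ → Maybe (Trie σ)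
children (node f) = f

mutual
  size : ∀ {σ} → Trie σ → ℕ
  size {σ} (node f) = suc (sumFin σ (λ a → sizeM (f a)))

  sizeM : ∀ {σ} → Maybe (Trie σ) → ℕ
  sizeM nothing  = 0
  sizeM (just t) = size t

data Reach {σ : ℕ} : Trie σ → List (Fin σ) → Trie σ → Set where
  here : ∀ {t} → Reach t [] t
  step : ∀ {f a t w v} → f a ≡ just t → Reach t w v → Reach (node f) (a ∷ w) v

Leaf : ∀ {σ} → Trie σ → Set
Leaf t = ∀ a → children t a ≡ nothing

Suffix : ∀ {σ} → Trie σ → List (Fin σ) → Set
Suffix T w = ∃ λ u → (∃ λ x → Reach T x u) × (∃ λ l → Reach u w l × Leaf l)

record DFA (σ : ℕ) : Set where
  field
    states  : ℕ
    initial : Fin states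
    final   : Fin states → Bool
    δ       : Fin states → Fin σ → Maybe (Fin states)

open DFA public

run : ∀ {σ} (D : DFA σ) → Fin (states D) → List (Fin σ) → Maybe (Fin (states D))
run D q []      = just q
run D q (a ∷ w) with δ D q a
... | nothing = nothing
... | just q' = run D q' w

Accepts : ∀ {σ} → DFA σ → List (Fin σ) → Set
Accepts D w = ∃ λ q → run D (initial D) w ≡ just q × final D q ≡ true

Recognizes : ∀ {σ} → DFA σ → (List (Fin σ) → Set) → Set
Recognizes D L = ∀ w → Accepts D w ⇔ L w

SmallestDFA : ∀ {σ} → DFA σ → (List (Fin σ) → Set) → Set
SmallestDFA {σ} D L =
  Recognizes D L × (∀ (D' : DFA σ) → Recognizes D' L → states D ≤ states D')

isJustℕ : ∀ {A : Set} → Maybe A → ℕ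
isJustℕ nothing  = 0
isJustℕ (just _) = 1

transitions : ∀ {σ} → DFA σ → ℕ
transitions {σ} D = sumFin (states D) (λ q → sumFin σ (λ a → isJustℕ (δ D q a)))

-- After reading w, an automaton for Suffix(T) only needs to know occ(w), the set
-- of nodes of T whose root path ends with w: equal sets have equal futures. Two such sets are
-- nested or disjoint (if they share a node, both reversed words are prefixes of its reversed
-- root path), so the nonempty ones form a laminar family on the n nodes; there are at most 2n
-- of them. An explicit injection into Fin n ⊎ Fin n: with m the least element of S, send S to
-- m if S = occ(pₘ) for the root path pₘ of m, and otherwise to the least element of S outside
-- the largest member of the family strictly inside S that contains m. This gives a DFA with
-- 2n states, hence the smallest one has at most 2σn transitions.
--
-- Take a path of k zero-edges ending in a node with σ leaf children, where
-- k + 1 ≥ σ. The states reached by 0ʲ, j ≤ k + 1, are pairwise distinct (0ⁱ0^(k+1-i) is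
-- accepted but no longer word is), and for j ≤ k each of them has all σ transitions.

module Submission where

open import Defs
open import Data.Nat using (ℕ; zero; suc; _+_; _*_; _∸_; _≤_; _<_; z≤n; s≤s)
import Data.Nat.Properties as ℕ
open import Algebra.Properties.CommutativeSemigroup ℕ.+-commutativeSemigroup using (x∙yz≈y∙xz)
open import Data.Nat.Tactic.RingSolver using (solve-∀)
open import Data.Fin
  using (Fin; zero; suc; toℕ; fromℕ; inject₁; fromℕ<; punchIn; punchOut; join; splitAt)
import Data.Fin.Properties as Fin
open import Data.Fin.Subset using (Subset; _∈_; _∉_; _⊆_)
open import Data.Vec using ([]; _∷_; here; there)
open import Data.Fin.Subset.Properties using (_∈?_; ⊆-antisym)
open import Data.Bool using (true; false)
open import Data.Maybe using (Maybe; just; nothing; maybe)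
import Data.Maybe.Properties as Maybe
open import Data.List
  using (List; []; _∷_; _++_; _∷ʳ_; [_]; length; lookup; take; reverse; map; inits; replicate)
import Data.List.Properties as List
open import Data.List.Relation.Unary.Any using (Any; here; there; any?; satisfied)
import Data.List.Relation.Unary.Any as Any
import Data.List.Relation.Unary.Any.Properties as Any
open import Data.List.Membership.Propositional using () renaming (_∈_ to _∈ₗ_)
import Data.List.Membership.Propositional.Properties as ∈ₗ
open import Data.List.Relation.Binary.Prefix.Heterogeneous using (Prefix; []; _∷_; _++ᵖ_)
import Data.List.Relation.Binary.Prefix.Heterogeneous.Properties as Prefix
open import Data.Product using (Σ; ∃; ∃₂; _×_; _,_; proj₁; proj₂; map₁; map₂)
open import Data.Sum using (_⊎_; inj₁; inj₂)
open import Data.Sum.Properties using (inj₂-injective)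
open import Function using (_∘_; id; _⇔_; mk⇔; Equivalence; case_of_)
open import Function.Construct.Composition using (_⇔-∘_)
open import Function.Construct.Symmetry using (⇔-sym)
open import Function.Definitions using (Injective)
open import Relation.Nullary using (Dec; yes; no; ¬_; does; contradiction)
open import Relation.Nullary.Decidable using (dec-true; does-⇔; decidable-stable; _×-dec_; ¬?)
open import Relation.Unary using (Pred; Decidable)
open import Relation.Binary using (DecidableEquality; tri<; tri≈; tri>)
open import Relation.Binary.PropositionalEquality hiding ([_]; J)

sumFin-cong : ∀ k {g h : Fin k → ℕ} → (∀ i → g i ≡ h i) → sumFin k g ≡ sumFin k h
sumFin-cong zero    g≗h = refl
sumFin-cong (suc k) g≗h = cong₂ _+_ (g≗h zero) (sumFin-cong k (g≗h ∘ suc))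

sumFin-const : ∀ k c → sumFin k (λ _ → c) ≡ k * c
sumFin-const zero    c = refl
sumFin-const (suc k) c = cong (c +_) (sumFin-const k c)

sumFin-0 : ∀ k → sumFin k (λ _ → 0) ≡ 0
sumFin-0 k = trans (sumFin-const k 0) (ℕ.*-zeroʳ k)

sumFin-≤ : ∀ k {g : Fin k → ℕ} {b} → (∀ i → g i ≤ b) → sumFin k g ≤ k * b
sumFin-≤ zero    g≤b = z≤n
sumFin-≤ (suc k) g≤b = ℕ.+-mono-≤ (g≤b zero) (sumFin-≤ k (g≤b ∘ suc))

sumFin-punchIn : ∀ k (g : Fin (suc k) → ℕ) i →
                 sumFin (suc k) g ≡ g i + sumFin k (g ∘ punchIn i)
sumFin-punchIn k       g zero    = refl
sumFin-punchIn (suc k) g (suc i) = begin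
  g zero + sumFin (suc k) (g ∘ suc)
    ≡⟨ cong (g zero +_) (sumFin-punchIn k (g ∘ suc) i) ⟩
  g zero + (g (suc i) + sumFin k (g ∘ suc ∘ punchIn i))
    ≡⟨ x∙yz≈y∙xz (g zero) (g (suc i)) _ ⟩
  g (suc i) + (g zero + sumFin k (g ∘ suc ∘ punchIn i)) ∎
  where open ≡-Reasoning

sumFin-∘-injective : ∀ {m n} {f : Fin m → Fin n} → Injective _≡_ _≡_ f →
                     (g : Fin n → ℕ) → sumFin m (g ∘ f) ≤ sumFin n g
sumFin-∘-injective {zero}          f-inj g = z≤n
sumFin-∘-injective {suc m} {zero}  {f} f-inj g with () ← f zero
sumFin-∘-injective {suc m} {suc n} {f} f-inj g = begin
  g (f zero) + sumFin m (g ∘ f ∘ suc)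
    ≡⟨ cong (g (f zero) +_) (sumFin-cong m (λ j → cong g (sym (Fin.punchIn-punchOut (f₀≢ j))))) ⟩
  g (f zero) + sumFin m (g ∘ punchIn (f zero) ∘ f′)
    ≤⟨ ℕ.+-monoʳ-≤ (g (f zero)) (sumFin-∘-injective f′-injective (g ∘ punchIn (f zero))) ⟩
  g (f zero) + sumFin n (g ∘ punchIn (f zero))
    ≡⟨ sumFin-punchIn n g (f zero) ⟨
  sumFin (suc n) g ∎
  where
  open ℕ.≤-Reasoning
  f₀≢ : ∀ j → f zero ≢ f (suc j)
  f₀≢ j = (λ ()) ∘ f-inj
  f′ : Fin m → Fin n
  f′ j = punchOut (f₀≢ j)
  f′-injective : Injective _≡_ _≡_ f′
  f′-injective {i} {j} = Fin.suc-injective ∘ f-inj ∘ Fin.punchOut-injective (f₀≢ i) (f₀≢ j)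

Least : ∀ {n p} → Pred (Fin n) p → Pred (Fin n) p
Least P i = P i × (∀ {j} → P j → toℕ i ≤ toℕ j)

least? : ∀ {n p} {P : Pred (Fin n) p} → Decidable P → ∃ (Least P) ⊎ (∀ i → ¬ P i)
least? {zero}  P? = inj₂ λ ()
least? {suc n} P? with P? zero | least? (P? ∘ suc)
... | yes P0 | _                   = inj₁ (zero , P0 , λ _ → z≤n)
... | no ¬P0 | inj₁ (i , Pi , min) = inj₁ (suc i , Pi , λ { {zero} P0 → contradiction P0 ¬P0
                                                          ; {suc j} Pj → s≤s (min Pj) })
... | no ¬P0 | inj₂ none           = inj₂ λ { zero → ¬P0 ; (suc i) → none i }

least : ∀ {n p} {P : Pred (Fin n) p} → Decidable P → ∃ P → ∃ (Least P)
least P? (i , Pi) with least? P?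
... | inj₁ l    = l
... | inj₂ none = contradiction Pi (none i)

fromDec : ∀ {n p} {P : Pred (Fin n) p} → Decidable P → Subset n
fromDec {zero}  P? = []
fromDec {suc n} P? = does (P? zero) ∷ fromDec (P? ∘ suc)

∈-fromDec⁺ : ∀ {n p} {P : Pred (Fin n) p} (P? : Decidable P) {i} → P i → i ∈ fromDec P?
∈-fromDec⁺ P? {zero} P0 with P? zero
... | yes _  = here
... | no ¬P0 = contradiction P0 ¬P0
∈-fromDec⁺ P? {suc i} Pi = there (∈-fromDec⁺ (P? ∘ suc) Pi)

∈-fromDec⁻ : ∀ {n p} {P : Pred (Fin n) p} (P? : Decidable P) {i} → i ∈ fromDec P? → P i
∈-fromDec⁻ P? {zero} 0∈ with P? zero | 0∈
... | yes P0 | _ = P0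
∈-fromDec⁻ P? {suc i} (there i∈) = ∈-fromDec⁻ (P? ∘ suc) i∈

module _ {a} {A : Set a} where

  infix 4 _≼_
  _≼_ : List A → List A → Set a
  _≼_ = Prefix _≡_

  ≼-refl : ∀ xs → xs ≼ xs
  ≼-refl []       = []
  ≼-refl (x ∷ xs) = refl ∷ ≼-refl xs

  ≼-trans : ∀ {r s t} → r ≼ s → s ≼ t → r ≼ t
  ≼-trans = Prefix.trans trans

  ≼-comparable : ∀ {r s t} → r ≼ t → s ≼ t → r ≼ s ⊎ s ≼ r
  ≼-comparable []             _              = inj₁ []
  ≼-comparable (_ ∷ _)        []             = inj₂ []
  ≼-comparable (refl ∷ r≼t)   (refl ∷ s≼t)   with ≼-comparable r≼t s≼t
  ... | inj₁ r≼s = inj₁ (refl ∷ r≼s)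
  ... | inj₂ s≼r = inj₂ (refl ∷ s≼r)

  take-≼ : ∀ k xs → take k xs ≼ xs
  take-≼ zero    xs       = []
  take-≼ (suc k) []       = []
  take-≼ (suc k) (x ∷ xs) = refl ∷ take-≼ k xs

  take-≼-take : ∀ {k l} xs → k ≤ l → take k xs ≼ take l xs
  take-≼-take xs       z≤n       = []
  take-≼-take []       (s≤s k≤l) = []
  take-≼-take (x ∷ xs) (s≤s k≤l) = refl ∷ take-≼-take xs k≤l

  take-length-≼ : ∀ {r s} → r ≼ s → take (length r) s ≡ r
  take-length-≼ []          = refl
  take-length-≼ (refl ∷ r≼s) = cong (_ ∷_) (take-length-≼ r≼s)

  ≼⇒++ : ∀ {r s} → r ≼ s → ∃ λ z → s ≡ r ++ z
  ≼⇒++ []           = _ , refl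
  ≼⇒++ (refl ∷ r≼s) = map₂ (cong (_ ∷_)) (≼⇒++ r≼s)

  ends-with⇔reverse-≼ : ∀ {w p} → (∃ λ x → p ≡ x ++ w) ⇔ reverse w ≼ reverse p
  ends-with⇔reverse-≼ {w = w} {p} = mk⇔
    (λ { (x , refl) →
      subst (reverse w ≼_) (sym (List.reverse-++ x w)) (≼-refl (reverse w) ++ᵖ reverse x) })
    (λ rw≼rp → let z , rp≡ = ≼⇒++ rw≼rp in reverse z , (begin
      p                               ≡⟨ List.reverse-involutive p ⟨
      reverse (reverse p)             ≡⟨ cong reverse rp≡ ⟩
      reverse (reverse w ++ z)        ≡⟨ List.reverse-++ (reverse w) z ⟩
      reverse z ++ reverse (reverse w) ≡⟨ cong (reverse z ++_) (List.reverse-involutive w) ⟩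
      reverse z ++ w                  ∎))
    where open ≡-Reasoning

  ≼⇒∈-inits : ∀ {r s} → r ≼ s → r ∈ₗ inits s
  ≼⇒∈-inits []           = here refl
  ≼⇒∈-inits (refl ∷ r≼s) = there (∈ₗ.∈-map⁺ (_ ∷_) (≼⇒∈-inits r≼s))

module _ {σ} (D : DFA σ) where

  run-∷-just : ∀ {q a q′} w → δ D q a ≡ just q′ → run D q (a ∷ w) ≡ run D q′ w
  run-∷-just w δ≡ rewrite δ≡ = refl

  run-∷-nothing : ∀ {q a} w → δ D q a ≡ nothing → run D q (a ∷ w) ≡ nothing
  run-∷-nothing w δ≡ rewrite δ≡ = refl

  run-++ : ∀ {q q′} u v → run D q u ≡ just q′ → run D q (u ++ v) ≡ run D q′ v
  run-++         []      v refl = refl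
  run-++ {q} (a ∷ u) v r with δ D q a
  run-++         (a ∷ u) v r  | just q₁ = run-++ u v r

  run-[] : ∀ {q a q′} → run D q [ a ] ≡ just q′ → δ D q a ≡ just q′
  run-[] {q} {a} r with δ D q a
  run-[]         r  | just q₁ = r

  δ-defined : ∀ {q q′ q″} u a → run D q u ≡ just q′ → run D q (u ∷ʳ a) ≡ just q″ →
              δ D q′ a ≡ just q″
  δ-defined u a u↦q′ ua↦q″ = run-[] (trans (sym (run-++ u [ a ] u↦q′)) ua↦q″)

  same-state-same-future : ∀ u u′ v {q} →
                           run D (initial D) u ≡ just q → run D (initial D) u′ ≡ just q →
                           Accepts D (u ++ v) → Accepts D (u′ ++ v)
  same-state-same-future u u′ v u↦q u′↦q (q″ , uv↦q″ , q″-final) =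
    q″ , trans (run-++ u′ v u′↦q) (trans (sym (run-++ u v u↦q)) uv↦q″) , q″-final

  outdegree : Fin (states D) → ℕ
  outdegree q = sumFin σ (λ a → isJustℕ (δ D q a))

  transitions-≤ : transitions D ≤ states D * σ
  transitions-≤ = sumFin-≤ (states D) λ q →
    ℕ.≤-trans (sumFin-≤ σ (isJustℕ≤1 ∘ δ D q)) (ℕ.≤-reflexive (ℕ.*-identityʳ σ))
    where
    isJustℕ≤1 : ∀ {B : Set} (m : Maybe B) → isJustℕ m ≤ 1
    isJustℕ≤1 nothing  = z≤n
    isJustℕ≤1 (just _) = s≤s z≤n

-- κ assigns to each word its class under a right congruence of finite index saturating L,
-- with nothing for the class of dead words; the representatives meet every other class.
module QuotientAutomaton
  {σ N : ℕ} (L : List (Fin σ) → Set) (L? : Decidable L)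
  (κ : List (Fin σ) → Maybe (Fin N))
  (κ-∷ʳ : ∀ {u v k} a → κ u ≡ just k → κ v ≡ just k → κ (u ∷ʳ a) ≡ κ (v ∷ʳ a))
  (κ-dead : ∀ {u} a → κ u ≡ nothing → κ (u ∷ʳ a) ≡ nothing)
  (L-resp : ∀ {u v k} → κ u ≡ just k → κ v ≡ just k → L u → L v)
  (L-live : ∀ {u} → L u → ∃ λ k → κ u ≡ just k)
  (representatives : List (List (Fin σ)))
  (represented : ∀ {u k} → κ u ≡ just k → Any (λ v → κ v ≡ just k) representatives)
  {start : Fin N} (κ-[] : κ [] ≡ just start)
  where

  representative : Fin N → Maybe (List (Fin σ))
  representative k with any? (λ v → Maybe.≡-dec Fin._≟_ (κ v) (just k)) representatives
  ... | yes found = just (proj₁ (satisfied found))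
  ... | no  _     = nothing

  representative-κ : ∀ {u k} → κ u ≡ just k →
                     ∃ λ v → representative k ≡ just v × κ v ≡ just k
  representative-κ {k = k} κu with any? (λ v → Maybe.≡-dec Fin._≟_ (κ v) (just k)) representatives
  ... | yes found = _ , refl , proj₂ (satisfied found)
  ... | no ¬found = contradiction (represented κu) ¬found

  automaton : DFA σ
  automaton = record
    { states  = N
    ; initial = start
    ; final   = λ k → maybe (does ∘ L?) false (representative k)
    ; δ       = λ k a → maybe (λ v → κ (v ∷ʳ a)) nothing (representative k)
    }

  δ-κ : ∀ {u k} a → κ u ≡ just k → δ automaton k a ≡ κ (u ∷ʳ a)
  δ-κ a κu with v , rep≡v , κv ← representative-κ κu rewrite rep≡v = κ-∷ʳ a κv κu

  final-κ : ∀ {u k} → κ u ≡ just k → final automaton k ≡ does (L? u)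
  final-κ κu with v , rep≡v , κv ← representative-κ κu rewrite rep≡v =
    does-⇔ (mk⇔ (L-resp κv κu) (L-resp κu κv)) (L? _) (L? _)

  κ-dead-++ : ∀ {u} w → κ u ≡ nothing → κ (u ++ w) ≡ nothing
  κ-dead-++ {u} []      κu = trans (cong κ (List.++-identityʳ u)) κu
  κ-dead-++ {u} (a ∷ w) κu = trans (cong κ (sym (List.∷ʳ-++ u a w))) (κ-dead-++ w (κ-dead a κu))

  run-κ : ∀ {u k} w → κ u ≡ just k → run automaton k w ≡ κ (u ++ w)
  run-κ {u} []      κu = trans (sym κu) (cong κ (sym (List.++-identityʳ u)))
  run-κ {u} {k} (a ∷ w) κu with κ (u ∷ʳ a) in κua
  ... | just k′ = begin
    run automaton k (a ∷ w)  ≡⟨ run-∷-just automaton w (trans (δ-κ a κu) κua) ⟩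
    run automaton k′ w       ≡⟨ run-κ w κua ⟩
    κ ((u ∷ʳ a) ++ w)        ≡⟨ cong κ (List.∷ʳ-++ u a w) ⟩
    κ (u ++ a ∷ w)           ∎
    where open ≡-Reasoning
  ... | nothing = begin
    run automaton k (a ∷ w)  ≡⟨ run-∷-nothing automaton w (trans (δ-κ a κu) κua) ⟩
    nothing                  ≡⟨ κ-dead-++ w κua ⟨
    κ ((u ∷ʳ a) ++ w)        ≡⟨ cong κ (List.∷ʳ-++ u a w) ⟩
    κ (u ++ a ∷ w)           ∎
    where open ≡-Reasoning

  recognizes : Recognizes automaton L
  recognizes w = mk⇔ accepted⇒L L⇒accepted
    where
    run-start : run automaton start w ≡ κ w
    run-start = run-κ w κ-[]

    accepted⇒L : Accepts automaton w → L w
    accepted⇒L (k , w↦k , k-final) with L? w | final-κ (trans (sym run-start) w↦k)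
    ... | yes Lw | _     = Lw
    ... | no  _  | f≡ff  = contradiction (trans (sym k-final) f≡ff) λ ()

    L⇒accepted : L w → Accepts automaton w
    L⇒accepted Lw with k , κw ← L-live Lw =
      k , trans run-start κw , trans (final-κ κw) (dec-true (L? w) Lw)

module Occurrences {A : Set} (_≟_ : DecidableEquality A) {n : ℕ} (q : Fin n → List A) where

  occ : List A → Subset n
  occ r = fromDec (λ i → Prefix.prefix? _≟_ r (q i))

  ∈-occ⁺ : ∀ {r i} → r ≼ q i → i ∈ occ r
  ∈-occ⁺ = ∈-fromDec⁺ (λ i → Prefix.prefix? _≟_ _ (q i))

  ∈-occ⁻ : ∀ {r i} → i ∈ occ r → r ≼ q i
  ∈-occ⁻ = ∈-fromDec⁻ (λ i → Prefix.prefix? _≟_ _ (q i))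

  occ-antitone : ∀ {r s} → r ≼ s → occ s ⊆ occ r
  occ-antitone r≼s i∈ = ∈-occ⁺ (≼-trans r≼s (∈-occ⁻ i∈))

  infix 4 _∈_∖_
  _∈_∖_ : Fin n → Subset n → Subset n → Set
  i ∈ S ∖ T = i ∈ S × i ∉ T

  _∈?_∖_ : ∀ i S T → Dec (i ∈ S ∖ T)
  i ∈? S ∖ T = (i ∈? S) ×-dec ¬? (i ∈? T)

  -- For S = occ r, occ w is the largest occurrence set strictly inside S containing m,
  -- and x is the least element of S outside it.
  record Branch (S : Subset n) (m : Fin n) : Set where
    field
      w          : List A
      w≼qm       : w ≼ q m
      w-shortest : ∀ {v} → v ≼ q m → ∃ (_∈ S ∖ occ v) → w ≼ v
      x          : Fin n
      x-least    : Least (_∈ S ∖ occ w) x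

    x∈S : x ∈ S
    x∈S = proj₁ (proj₁ x-least)

    x∉w : x ∉ occ w
    x∉w = proj₂ (proj₁ x-least)

  data Shape (S : Subset n) (m : Fin n) : Fin n ⊎ Fin n → Set where
    closed    : S ⊆ occ (q m) → Shape S m (inj₁ m)
    branching : (b : Branch S m) → Shape S m (inj₂ (Branch.x b))

  shape : ∀ S m → ∃ (Shape S m)
  shape S m with least? (λ (ℓ : Fin (suc (length (q m)))) →
                            Fin.any? (_∈? S ∖ occ (take (toℕ ℓ) (q m))))
  ... | inj₂ none = inj₁ m , closed S⊆
    where
    take-all-qm : take (toℕ (fromℕ (length (q m)))) (q m) ≡ q m
    take-all-qm = trans (cong (λ k → take k (q m)) (Fin.toℕ-fromℕ _)) (List.take-all _ (q m) ℕ.≤-refl)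

    S⊆ : S ⊆ occ (q m)
    S⊆ {i} i∈S = decidable-stable (i ∈? occ (q m)) λ i∉ →
      none (fromℕ (length (q m))) (i , i∈S , i∉ ∘ subst (λ u → i ∈ occ u) take-all-qm)
  ... | inj₁ (ℓ , escape , ℓ-least) = inj₂ _ , branching record
    { w          = take (toℕ ℓ) (q m)
    ; w≼qm       = take-≼ (toℕ ℓ) (q m)
    ; w-shortest = shortest
    ; x          = proj₁ x-least
    ; x-least    = proj₂ x-least
    }
    where
    x-least = least (_∈? S ∖ occ (take (toℕ ℓ) (q m))) escape

    shortest : ∀ {v} → v ≼ q m → ∃ (_∈ S ∖ occ v) → take (toℕ ℓ) (q m) ≼ v
    shortest {v} v≼qm v-escape = subst (take (toℕ ℓ) (q m) ≼_) take-ℓᵥ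
      (take-≼-take (q m) (ℓ-least (subst (λ u → ∃ (_∈ S ∖ occ u)) (sym take-ℓᵥ) v-escape)))
      where
      ℓᵥ : Fin (suc (length (q m)))
      ℓᵥ = fromℕ< (s≤s (Prefix.length-mono v≼qm))
      take-ℓᵥ : take (toℕ ℓᵥ) (q m) ≡ v
      take-ℓᵥ = trans (cong (λ k → take k (q m)) (Fin.toℕ-fromℕ< _)) (take-length-≼ v≼qm)

  code : Subset n → Fin n → Fin n ⊎ Fin n
  code S m = proj₁ (shape S m)

  closed-occ : ∀ {r m} → m ∈ occ r → occ r ⊆ occ (q m) → occ r ≡ occ (q m)
  closed-occ m∈ ⊆qm = ⊆-antisym ⊆qm (occ-antitone (∈-occ⁻ m∈))

  -- If m ∈ occ r′ then w ≼ r′, which would put x on the branch w. Otherwise x and the least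
  -- element m′ of occ r′ both lie in occ r outside w, so x = m′; but m′ lies on the branch of
  -- occ r′ and x does not.
  branch-injective : ∀ {r r′ m m′} → r ≼ r′ → Least (_∈ occ r′) m′ →
                     (b : Branch (occ r) m) (b′ : Branch (occ r′) m′) → Branch.x b ≡ Branch.x b′ →
                     occ r ≡ occ r′
  branch-injective {r} {r′} {m} {m′} r≼r′ (m′∈ , m′-least) b b′ x≡x′ =
    ⊆-antisym S⊆S′ (occ-antitone r≼r′)
    where
    open Branch b
    module b′ = Branch b′

    x∈S′ : x ∈ occ r′
    x∈S′ = subst (_∈ occ r′) (sym x≡x′) b′.x∈S

    w⋠r′ : ¬ w ≼ r′
    w⋠r′ w≼r′ = x∉w (occ-antitone w≼r′ x∈S′)

    m′∉w : m ∉ occ r′ → m′ ∉ occ w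
    m′∉w m∉ m′∈w with ≼-comparable (∈-occ⁻ m′∈w) (∈-occ⁻ m′∈)
    ... | inj₁ w≼r′ = w⋠r′ w≼r′
    ... | inj₂ r′≼w = m∉ (occ-antitone r′≼w (∈-occ⁺ w≼qm))

    m′≡x′ : m ∉ occ r′ → m′ ≡ b′.x
    m′≡x′ m∉ = trans (Fin.toℕ-injective (ℕ.≤-antisym (m′-least x∈S′) x≤m′)) x≡x′
      where x≤m′ = proj₂ x-least (occ-antitone r≼r′ m′∈ , m′∉w m∉)

    S⊆S′ : occ r ⊆ occ r′
    S⊆S′ {i} i∈ = decidable-stable (i ∈? occ r′) λ i∉ → case m ∈? occ r′ of λ where
      (yes m∈) → w⋠r′ (w-shortest (∈-occ⁻ m∈) (i , i∈ , i∉))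
      (no  m∉) → b′.x∉w (subst (_∈ occ b′.w) (m′≡x′ m∉) (∈-occ⁺ b′.w≼qm))

  code-injective : ∀ {r r′ m m′} → Least (_∈ occ r) m → Least (_∈ occ r′) m′ →
                   code (occ r) m ≡ code (occ r′) m′ → occ r ≡ occ r′
  code-injective {r} {r′} {m} {m′} m-least m′-least with shape (occ r) m | shape (occ r′) m′
  ... | _ , closed ⊆qm | _ , closed ⊆qm′ = λ { refl →
        trans (closed-occ (proj₁ m-least) ⊆qm) (sym (closed-occ (proj₁ m′-least) ⊆qm′)) }
  ... | _ , closed _    | _ , branching _ = λ ()
  ... | _ , branching _ | _ , closed _    = λ ()
  ... | _ , branching b | _ , branching b′ = λ x≡x′ → let x≡ = inj₂-injective x≡x′ in
        case ≼-comparable (∈-occ⁻ (Branch.x∈S b))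
                          (∈-occ⁻ (subst (_∈ occ r′) (sym x≡) (Branch.x∈S b′))) of λ where
          (inj₁ r≼r′) → branch-injective r≼r′ m′-least b b′ x≡
          (inj₂ r′≼r) → sym (branch-injective r′≼r m-least b′ b (sym x≡))

  state : Subset n → Maybe (Fin (n + n))
  state S with least? (_∈? S)
  ... | inj₁ (m , _) = just (join n n (code S m))
  ... | inj₂ _       = nothing

  state-occ-injective : ∀ {r r′ k} → state (occ r) ≡ just k → state (occ r′) ≡ just k →
                        occ r ≡ occ r′
  state-occ-injective {r} {r′} with least? (_∈? occ r) | least? (_∈? occ r′)
  ... | inj₁ (m , m-least) | inj₁ (m′ , m′-least) = λ { refl code≡ →
        code-injective m-least m′-least (join-injective (sym (Maybe.just-injective code≡))) }
    where
    join-injective : ∀ {c c′ : Fin n ⊎ Fin n} → join n n c ≡ join n n c′ → c ≡ c′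
    join-injective {c} {c′} e =
      trans (sym (Fin.splitAt-join n n c)) (trans (cong (splitAt n) e) (Fin.splitAt-join n n c′))

  state-live : ∀ {S i} → i ∈ S → ∃ λ k → state S ≡ just k
  state-live {S} {i} i∈ with least? (_∈? S)
  ... | inj₁ _    = _ , refl
  ... | inj₂ none = contradiction i∈ (none i)

  state-just⁻ : ∀ {S k} → state S ≡ just k → ∃ (_∈ S)
  state-just⁻ {S} with least? (_∈? S)
  ... | inj₁ (m , m∈ , _) = λ _ → m , m∈

  state-empty : ∀ {S} → (∀ i → i ∉ S) → state S ≡ nothing
  state-empty {S} empty with least? (_∈? S)
  ... | inj₁ (m , m∈ , _) = contradiction m∈ (empty m)
  ... | inj₂ _            = refl

  module _ (q-tail : ∀ {i a r} → q i ≡ a ∷ r → ∃ λ j → q j ≡ r) where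

    ≼-tail : ∀ {a r i} → a ∷ r ≼ q i →
             ∃ λ j → r ≼ q j × (∀ {r′} → r′ ≼ q j → a ∷ r′ ≼ q i)
    ≼-tail {i = i} ar≼ with q i in qi≡
    ≼-tail (refl ∷ r≼s) | _ ∷ s with j , qj≡s ← q-tail qi≡ =
      j , subst (_ ≼_) (sym qj≡s) r≼s , λ r′≼qj → refl ∷ subst (_ ≼_) qj≡s r′≼qj

    occ-∷-⊆ : ∀ {a r r′} → occ r ⊆ occ r′ → occ (a ∷ r) ⊆ occ (a ∷ r′)
    occ-∷-⊆ ⊆′ i∈ with j , r≼qj , extend ← ≼-tail (∈-occ⁻ i∈) =
      ∈-occ⁺ (extend (∈-occ⁻ (⊆′ (∈-occ⁺ r≼qj))))

    occ-∷-cong : ∀ {a r r′} → occ r ≡ occ r′ → occ (a ∷ r) ≡ occ (a ∷ r′)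
    occ-∷-cong occ≡ =
      ⊆-antisym (occ-∷-⊆ (subst (_ ⊆_) occ≡ id)) (occ-∷-⊆ (subst (_⊆ _) occ≡ id))

    occ-∷-nonempty : ∀ {a r i} → i ∈ occ (a ∷ r) → ∃ (_∈ occ r)
    occ-∷-nonempty i∈ with j , r≼qj , _ ← ≼-tail (∈-occ⁻ i∈) = j , ∈-occ⁺ r≼qj

concatFin : ∀ {B : Set} k → (Fin k → List B) → List B
concatFin zero    g = []
concatFin (suc k) g = g zero ++ concatFin k (g ∘ suc)

module _ {B : Set} where

  length-concatFin : ∀ k (g : Fin k → List B) → length (concatFin k g) ≡ sumFin k (length ∘ g)
  length-concatFin zero    g = refl
  length-concatFin (suc k) g =
    trans (List.length-++ (g zero)) (cong (length (g zero) +_) (length-concatFin k (g ∘ suc)))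

  ∈-concatFin⁺ : ∀ k {g : Fin k → List B} {x} i → x ∈ₗ g i → x ∈ₗ concatFin k g
  ∈-concatFin⁺ (suc k)     zero    x∈ = ∈ₗ.∈-++⁺ˡ x∈
  ∈-concatFin⁺ (suc k) {g} (suc i) x∈ = ∈ₗ.∈-++⁺ʳ (g zero) (∈-concatFin⁺ k i x∈)

  ∈-concatFin⁻ : ∀ k (g : Fin k → List B) {x} → x ∈ₗ concatFin k g → ∃ λ i → x ∈ₗ g i
  ∈-concatFin⁻ (suc k) g x∈ with ∈ₗ.∈-++⁻ (g zero) x∈
  ... | inj₁ x∈g₀ = zero , x∈g₀
  ... | inj₂ x∈gs with i , x∈gᵢ ← ∈-concatFin⁻ k (g ∘ suc) x∈gs = suc i , x∈gᵢ

module _ {σ : ℕ} where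

  reach-++ : ∀ {t u v : Trie σ} {x y} → Reach t x u → Reach u y v → Reach t (x ++ y) v
  reach-++ here         u↝v = u↝v
  reach-++ (step e t↝u) u↝v = step e (reach-++ t↝u u↝v)

  reach-split : ∀ {t v : Trie σ} x {y} → Reach t (x ++ y) v → ∃ λ u → Reach t x u × Reach u y v
  reach-split []      t↝v          = _ , here , t↝v
  reach-split (a ∷ x) (step e t↝v) with u , t↝u , u↝v ← reach-split x t↝v = u , step e t↝u , u↝v

  Suffix⇔leaf-path : ∀ {T : Trie σ} {w} → Suffix T w ⇔ (∃₂ λ x l → Reach T (x ++ w) l × Leaf l)
  Suffix⇔leaf-path = mk⇔
    (λ { (u , (x , T↝u) , l , u↝l , leaf) → x , l , reach-++ T↝u u↝l , leaf })
    (λ { (x , l , T↝l , leaf) →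
      let u , T↝u , u↝l = reach-split x T↝l in u , (x , T↝u) , l , u↝l , leaf })

  mutual
    nodes : Trie σ → List (List (Fin σ) × Trie σ)
    nodes (node f) = ([] , node f) ∷ concatFin σ (λ a → nodesBelow a (f a))

    nodesBelow : Fin σ → Maybe (Trie σ) → List (List (Fin σ) × Trie σ)
    nodesBelow a nothing  = []
    nodesBelow a (just t) = map (map₁ (a ∷_)) (nodes t)

  mutual
    length-nodes : ∀ t → length (nodes t) ≡ size t
    length-nodes (node f) =
      cong suc (trans (length-concatFin σ _) (sumFin-cong σ (λ a → length-nodesBelow a (f a))))

    length-nodesBelow : ∀ a m → length (nodesBelow a m) ≡ sizeM m
    length-nodesBelow a nothing  = refl
    length-nodesBelow a (just t) = trans (List.length-map _ (nodes t)) (length-nodes t)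

  mutual
    ∈-nodes⁻ : ∀ {t p v} → (p , v) ∈ₗ nodes t → Reach t p v
    ∈-nodes⁻ {node f} (here refl) = here
    ∈-nodes⁻ {node f} (there pv∈) with a , pv∈a ← ∈-concatFin⁻ σ _ pv∈ =
      ∈-nodesBelow⁻ a refl pv∈a

    ∈-nodesBelow⁻ : ∀ {f} a {m} → f a ≡ m →
                    ∀ {p v} → (p , v) ∈ₗ nodesBelow a m → Reach (node f) p v
    ∈-nodesBelow⁻ a {just t} fa≡ pv∈ with _ , pv′∈ , refl ← ∈ₗ.∈-map⁻ (map₁ (a ∷_)) pv∈ =
      step fa≡ (∈-nodes⁻ pv′∈)

  ∈-nodes⁺ : ∀ {t p v} → Reach t p v → (p , v) ∈ₗ nodes t
  ∈-nodes⁺ {node f} here = here refl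
  ∈-nodes⁺ {node f} (step {a = a} fa≡ t↝v) =
    there (∈-concatFin⁺ σ a (subst (λ m → _ ∈ₗ nodesBelow a m) (sym fa≡)
                                   (∈ₗ.∈-map⁺ (map₁ (a ∷_)) (∈-nodes⁺ t↝v))))

leaf? : ∀ {σ} (t : Trie σ) → Dec (Leaf t)
leaf? t = Fin.all? (λ a → nothing? (children t a))
  where
  nothing? : ∀ {B : Set} (m : Maybe B) → Dec (m ≡ nothing)
  nothing? nothing  = yes refl
  nothing? (just _) = no λ ()

module SuffixAutomaton {σ} (T : Trie σ) where

  n : ℕ
  n = length (nodes T)

  path : Fin n → List (Fin σ)
  path i = proj₁ (lookup (nodes T) i)

  subtrie : Fin n → Trie σ
  subtrie i = proj₂ (lookup (nodes T) i)

  reach-node : ∀ i → Reach T (path i) (subtrie i)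
  reach-node i = ∈-nodes⁻ (∈ₗ.∈-lookup i)

  node-index : ∀ {p v} → Reach T p v → ∃ λ i → path i ≡ p × subtrie i ≡ v
  node-index T↝v with pv∈ ← ∈-nodes⁺ T↝v =
    Any.index pv∈ , cong proj₁ (sym (Any.lookup-index pv∈)) , cong proj₂ (sym (Any.lookup-index pv∈))

  -- Reading a word appends to it, so the occurrence sets are taken over the reversed paths.
  open Occurrences Fin._≟_ (reverse ∘ path)

  path-tail : ∀ {i a r} → reverse (path i) ≡ a ∷ r → ∃ λ j → reverse (path j) ≡ r
  path-tail {i} {a} {r} rev≡ =
    let u , T↝u , _ = reach-split (reverse r) (subst (λ p → Reach T p (subtrie i)) path≡ (reach-node i))
        j , path-j≡ , _ = node-index T↝u
    in j , trans (cong reverse path-j≡) (List.reverse-involutive r)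
    where
    path≡ : path i ≡ reverse r ∷ʳ a
    path≡ = trans (sym (List.reverse-involutive (path i)))
                  (trans (cong reverse rev≡) (List.unfold-reverse a r))

  LeafSuffix : List (Fin σ) → Set
  LeafSuffix w = ∃ λ i → i ∈ occ (reverse w) × Leaf (subtrie i)

  leafSuffix? : Decidable LeafSuffix
  leafSuffix? w = Fin.any? (λ i → (i ∈? occ (reverse w)) ×-dec leaf? (subtrie i))

  Suffix⇔LeafSuffix : ∀ {w} → Suffix T w ⇔ LeafSuffix w
  Suffix⇔LeafSuffix {w} = mk⇔ to from ⇔-∘ Suffix⇔leaf-path
    where
    to : (∃₂ λ x l → Reach T (x ++ w) l × Leaf l) → LeafSuffix w
    to (x , l , T↝l , leaf) = let i , path≡ , subtrie≡ = node-index T↝l in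
      i , ∈-occ⁺ (Equivalence.to (ends-with⇔reverse-≼ {w = w}) (x , path≡)) ,
      subst Leaf (sym subtrie≡) leaf
    from : LeafSuffix w → ∃₂ λ x l → Reach T (x ++ w) l × Leaf l
    from (i , i∈ , leaf) =
      let x , path≡ = Equivalence.from (ends-with⇔reverse-≼ {w = w}) (∈-occ⁻ i∈) in
      x , subtrie i , subst (λ p → Reach T p (subtrie i)) path≡ (reach-node i) , leaf

  κ : List (Fin σ) → Maybe (Fin (n + n))
  κ u = state (occ (reverse u))

  κ-∷ʳ-occ : ∀ u a → κ (u ∷ʳ a) ≡ state (occ (a ∷ reverse u))
  κ-∷ʳ-occ u a = cong (state ∘ occ) (List.reverse-++ u [ a ])

  κ-∷ʳ : ∀ {u v k} a → κ u ≡ just k → κ v ≡ just k → κ (u ∷ʳ a) ≡ κ (v ∷ʳ a)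
  κ-∷ʳ {u} {v} a κu κv = begin
    κ (u ∷ʳ a)                  ≡⟨ κ-∷ʳ-occ u a ⟩
    state (occ (a ∷ reverse u)) ≡⟨ cong state (occ-∷-cong path-tail (state-occ-injective κu κv)) ⟩
    state (occ (a ∷ reverse v)) ≡⟨ κ-∷ʳ-occ v a ⟨
    κ (v ∷ʳ a)                  ∎
    where open ≡-Reasoning

  κ-dead : ∀ {u} a → κ u ≡ nothing → κ (u ∷ʳ a) ≡ nothing
  κ-dead {u} a κu = trans (κ-∷ʳ-occ u a) (state-empty λ i i∈ →
    let j , j∈ = occ-∷-nonempty path-tail i∈ ; _ , κu≡ = state-live j∈ in
    contradiction (trans (sym κu) κu≡) λ ())

  LeafSuffix-resp : ∀ {u v k} → κ u ≡ just k → κ v ≡ just k → LeafSuffix u → LeafSuffix v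
  LeafSuffix-resp κu κv (i , i∈ , leaf) = i , subst (i ∈_) (state-occ-injective κu κv) i∈ , leaf

  LeafSuffix-live : ∀ {u} → LeafSuffix u → ∃ λ k → κ u ≡ just k
  LeafSuffix-live (i , i∈ , _) = state-live i∈

  representatives : List (List (Fin σ))
  representatives = concatFin n (λ i → map reverse (inits (reverse (path i))))

  represented : ∀ {u k} → κ u ≡ just k → Any (λ v → κ v ≡ just k) representatives
  represented {u} κu with i , i∈ ← state-just⁻ κu =
    Any.map (λ { refl → κu }) (∈-concatFin⁺ n i
      (subst (_∈ₗ _) (List.reverse-involutive u)
             (∈ₗ.∈-map⁺ reverse (≼⇒∈-inits (∈-occ⁻ i∈)))))

  κ-[] : ∃ λ k → κ [] ≡ just k
  κ-[] = state-live (∈-occ⁺ {i = proj₁ (node-index here)} [])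

  open QuotientAutomaton LeafSuffix leafSuffix? κ
         (λ {u} {v} → κ-∷ʳ {u} {v}) (λ {u} → κ-dead {u})
         (λ {u} {v} → LeafSuffix-resp {u} {v}) (λ {u} → LeafSuffix-live {u})
         representatives (λ {u} → represented {u}) (proj₂ κ-[])

  suffix-automaton : Σ (DFA σ) λ D → Recognizes D (Suffix T) × states D ≡ size T + size T
  suffix-automaton =
    automaton , (λ w → ⇔-sym Suffix⇔LeafSuffix ⇔-∘ recognizes w) , cong (λ k → k + k) (length-nodes T)

upper-bound : ∀ {σ} (T : Trie σ) (D : DFA σ) → SmallestDFA D (Suffix T) →
              transitions D ≤ 2 * σ * size T
upper-bound {σ} T D (_ , smallest) =
  let D′ , D′-recognizes , D′-states = SuffixAutomaton.suffix-automaton T in begin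
  transitions D         ≤⟨ transitions-≤ D ⟩
  states D * σ          ≤⟨ ℕ.*-monoˡ-≤ σ (ℕ.≤-trans (smallest D′ D′-recognizes)
                                                    (ℕ.≤-reflexive D′-states)) ⟩
  (size T + size T) * σ ≡⟨ double-product (size T) σ ⟩
  2 * σ * size T        ∎
  where
  open ℕ.≤-Reasoning
  double-product : ∀ m k → (m + m) * k ≡ 2 * k * m
  double-product = solve-∀

module Comb (s : ℕ) where

  zeros : ℕ → List (Fin (suc s))
  zeros j = replicate j zero

  leaf : Trie (suc s)
  leaf = node (λ _ → nothing)

  zero-edge : Trie (suc s) → Fin (suc s) → Maybe (Trie (suc s))
  zero-edge t zero    = just t
  zero-edge t (suc _) = nothing

  comb : ℕ → Trie (suc s)
  comb zero    = node (λ _ → just leaf)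
  comb (suc k) = node (zero-edge (comb k))

  size-comb : ∀ k → size (comb k) ≡ suc k + suc s
  size-comb zero    = cong suc (trans (sumFin-cong (suc s) (λ _ → cong suc (sumFin-0 (suc s))))
                                      (trans (sumFin-const (suc s) 1) (ℕ.*-identityʳ (suc s))))
  size-comb (suc k) = cong suc (trans (cong₂ _+_ (size-comb k) (sumFin-0 s)) (ℕ.+-identityʳ _))

  -- The words 0ʲ and 0ʲa of length at most t, i.e. those spelled downward from height t in a comb.
  infixr 5 0∷_
  data Descent : ℕ → List (Fin (suc s)) → Set where
    []     : ∀ {t} → Descent t []
    0∷_    : ∀ {t w} → Descent t w → Descent (suc t) (zero ∷ w)
    single : ∀ {t} a → Descent (suc t) [ a ]

  Descent-mono : ∀ {t t′ w} → t ≤ t′ → Descent t w → Descent t′ w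
  Descent-mono _          []         = []
  Descent-mono (s≤s t≤t′) (0∷ d)     = 0∷ Descent-mono t≤t′ d
  Descent-mono (s≤s _)    (single a) = single a

  Descent-length : ∀ {t w} → Descent t w → length w ≤ t
  Descent-length []         = z≤n
  Descent-length (0∷ d)     = s≤s (Descent-length d)
  Descent-length (single a) = s≤s z≤n

  Descent-zeros-++ : ∀ j {t w} → Descent t w → Descent (j + t) (zeros j ++ w)
  Descent-zeros-++ zero    d = d
  Descent-zeros-++ (suc j) d = 0∷ Descent-zeros-++ j d

  Descent-zeros : ∀ j → Descent j (zeros j)
  Descent-zeros zero    = []
  Descent-zeros (suc j) = 0∷ Descent-zeros j

  Descent-zeros-∷ʳ : ∀ j a → Descent (suc j) (zeros j ∷ʳ a)
  Descent-zeros-∷ʳ zero    a = single a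
  Descent-zeros-∷ʳ (suc j) a = 0∷ Descent-zeros-∷ʳ j a

  Descent-cases : ∀ {k w} → Descent (suc k) w →
                  w ≡ [] ⊎ ∃₂ λ j a → j ≤ k × w ≡ zeros j ∷ʳ a
  Descent-cases []              = inj₁ refl
  Descent-cases (single a)      = inj₂ (0 , a , z≤n , refl)
  Descent-cases {zero}  (0∷ []) = inj₂ (0 , zero , z≤n , refl)
  Descent-cases {suc k} (0∷ d) with Descent-cases d
  ... | inj₁ refl                 = inj₂ (0 , zero , z≤n , refl)
  ... | inj₂ (j , a , j≤k , refl) = inj₂ (suc j , a , s≤s j≤k , refl)

  leaf-reach : ∀ {w v} → Reach leaf w v → w ≡ []
  leaf-reach here         = refl
  leaf-reach (step () _)

  comb-descent : ∀ k {w v} → Reach (comb k) w v → Descent (suc k) w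
  comb-descent zero    here = []
  comb-descent (suc k) here = []
  comb-descent zero    (step refl leaf↝v) rewrite leaf-reach leaf↝v = single _
  comb-descent (suc k) (step {a = zero} refl comb↝v) = 0∷ comb-descent k comb↝v
  comb-descent (suc k) (step {a = suc _} () _)

  comb-descent-below : ∀ k {x u w v} → Reach (comb k) x u → Reach u w v → Descent (suc k) w
  comb-descent-below zero    here u↝v = comb-descent zero u↝v
  comb-descent-below (suc k) here u↝v = comb-descent (suc k) u↝v
  comb-descent-below zero    (step refl here) leaf↝v rewrite leaf-reach leaf↝v = []
  comb-descent-below zero    (step refl (step () _)) _
  comb-descent-below (suc k) (step {a = zero} refl comb↝u) u↝v =
    Descent-mono (ℕ.n≤1+n _) (comb-descent-below k comb↝u u↝v)
  comb-descent-below (suc k) (step {a = suc _} () _) _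

  comb-zeros : ∀ d j → Reach (comb (d + j)) (zeros d) (comb j)
  comb-zeros zero    j = here
  comb-zeros (suc d) j = step refl (comb-zeros d j)

  comb-leaf : ∀ k a → Reach (comb k) (zeros k ∷ʳ a) leaf
  comb-leaf zero    a = step refl here
  comb-leaf (suc k) a = step refl (comb-leaf k a)

  Suffix⇔Descent : ∀ {k w} → Suffix (comb k) w ⇔ Descent (suc k) w
  Suffix⇔Descent {k} {w} =
    mk⇔ (λ (_ , (_ , comb↝u) , _ , u↝l , _) → comb-descent-below k comb↝u u↝l) from
    where
    from : Descent (suc k) w → Suffix (comb k) w
    from d with Descent-cases d
    ... | inj₁ refl = leaf , (zeros k ∷ʳ zero , comb-leaf k zero) , leaf , here , λ _ → refl
    ... | inj₂ (j , a , j≤k , refl) =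
      comb j , (zeros (k ∸ j) , subst (λ h → Reach (comb h) (zeros (k ∸ j)) (comb j))
                                      (ℕ.m∸n+n≡m j≤k) (comb-zeros (k ∸ j) j)) ,
      leaf , comb-leaf j a , λ _ → refl

  descend : ∀ {h} → Fin (suc h) → Fin (suc s) → Maybe (Fin (suc h))
  descend zero    _       = nothing
  descend (suc t) zero    = just (inject₁ t)
  descend (suc t) (suc _) = just zero

  -- State t stands for height t in the comb; it accepts exactly Descent t.
  descent-automaton : ℕ → DFA (suc s)
  descent-automaton k = record
    { states  = suc (suc k)
    ; initial = fromℕ (suc k)
    ; final   = λ _ → true
    ; δ       = descend
    }

  module _ {k : ℕ} where

    run-descent⇒ : ∀ t w {t′} → run (descent-automaton k) t w ≡ just t′ → Descent (toℕ t) w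
    run-descent⇒ t       []            _ = []
    run-descent⇒ zero    (_ ∷ _)       ()
    run-descent⇒ (suc t) (zero ∷ w)    r =
      0∷ subst (λ h → Descent h w) (Fin.toℕ-inject₁ t) (run-descent⇒ (inject₁ t) w r)
    run-descent⇒ (suc t) (suc b ∷ [])  _ = single (suc b)
    run-descent⇒ (suc t) (suc b ∷ _ ∷ _) ()

    Descent⇒run : ∀ t w → Descent (toℕ t) w →
                  ∃ λ t′ → run (descent-automaton k) t w ≡ just t′
    Descent⇒run t       []          _              = t , refl
    Descent⇒run zero    (_ ∷ _)     ()
    Descent⇒run (suc t) (zero ∷ w)  (0∷ d)         =
      Descent⇒run (inject₁ t) w (subst (λ h → Descent h w) (sym (Fin.toℕ-inject₁ t)) d)
    Descent⇒run (suc t) (zero ∷ []) (single _)     = inject₁ t , refl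
    Descent⇒run (suc t) (suc b ∷ []) (single _)    = zero , refl

  descent-automaton-recognizes : ∀ k → Recognizes (descent-automaton k) (Suffix (comb k))
  descent-automaton-recognizes k w = ⇔-sym Suffix⇔Descent ⇔-∘ mk⇔
    (λ (_ , r , _) → subst (λ h → Descent h w) (Fin.toℕ-fromℕ (suc k)) (run-descent⇒ _ w r))
    (λ d → let t′ , r = Descent⇒run _ w (subst (λ h → Descent h w) (sym (Fin.toℕ-fromℕ (suc k))) d)
           in t′ , r , refl)

  module _ {k} (D : DFA (suc s)) (D-recognizes : Recognizes D (Suffix (comb k))) where

    Descent⇒accepted : ∀ w → Descent (suc k) w → Accepts D w
    Descent⇒accepted w = Equivalence.from (Suffix⇔Descent ⇔-∘ D-recognizes w)

    accepted⇒Descent : ∀ w → Accepts D w → Descent (suc k) w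
    accepted⇒Descent w = Equivalence.to (Suffix⇔Descent ⇔-∘ D-recognizes w)

    zeros-accepted : ∀ (j : Fin (suc (suc k))) → Accepts D (zeros (toℕ j))
    zeros-accepted j =
      Descent⇒accepted (zeros (toℕ j)) (Descent-mono (Fin.toℕ≤pred[n] j) (Descent-zeros (toℕ j)))

    zeros-state : Fin (suc (suc k)) → Fin (states D)
    zeros-state j = proj₁ (zeros-accepted j)

    zeros-state-run : ∀ j → run D (initial D) (zeros (toℕ j)) ≡ just (zeros-state j)
    zeros-state-run j = proj₁ (proj₂ (zeros-accepted j))

    -- 0ⁱ can be followed by 0^(k+1-i), and 0ʲ cannot: the result would be longer than k + 1.
    zeros-state-separates : ∀ {i j} → toℕ i < toℕ j → zeros-state i ≢ zeros-state j
    zeros-state-separates {i} {j} i<j i≡j =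
      ℕ.<⇒≱ too-long (Descent-length (accepted⇒Descent (zeros (toℕ j) ++ zeros rest) accepted))
      where
      rest = suc k ∸ toℕ i

      i+rest≡ : toℕ i + rest ≡ suc k
      i+rest≡ = ℕ.m+[n∸m]≡n (Fin.toℕ≤pred[n] i)

      accepted : Accepts D (zeros (toℕ j) ++ zeros rest)
      accepted = same-state-same-future D (zeros (toℕ i)) (zeros (toℕ j)) (zeros rest)
        (zeros-state-run i) (trans (zeros-state-run j) (cong just (sym i≡j)))
        (Descent⇒accepted (zeros (toℕ i) ++ zeros rest)
          (subst (λ h → Descent h (zeros (toℕ i) ++ zeros rest)) i+rest≡
                 (Descent-zeros-++ (toℕ i) (Descent-zeros rest))))

      too-long : suc k < length (zeros (toℕ j) ++ zeros rest)
      too-long = begin-strict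
        suc k                                        ≡⟨ i+rest≡ ⟨
        toℕ i + rest                                 <⟨ ℕ.+-monoˡ-< rest i<j ⟩
        toℕ j + rest                                 ≡⟨ cong₂ _+_ (List.length-replicate (toℕ j))
                                                                  (List.length-replicate rest) ⟨
        length (zeros (toℕ j)) + length (zeros rest) ≡⟨ List.length-++ (zeros (toℕ j)) ⟨
        length (zeros (toℕ j) ++ zeros rest)         ∎
        where open ℕ.≤-Reasoning

    zeros-state-injective : Injective _≡_ _≡_ zeros-state
    zeros-state-injective {i} {j} i≡j with ℕ.<-cmp (toℕ i) (toℕ j)
    ... | tri< i<j _ _  = contradiction i≡j (zeros-state-separates i<j)
    ... | tri≈ _ i≡j′ _ = Fin.toℕ-injective i≡j′
    ... | tri> _ _ j<i  = contradiction (sym i≡j) (zeros-state-separates j<i)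

    states-lower : suc (suc k) ≤ states D
    states-lower = Fin.injective⇒≤ zeros-state-injective

    full-outdegree : ∀ (j : Fin (suc k)) → outdegree D (zeros-state (inject₁ j)) ≡ suc s
    full-outdegree j = begin
      outdegree D (zeros-state (inject₁ j)) ≡⟨ sumFin-cong (suc s) defined ⟩
      sumFin (suc s) (λ _ → 1)              ≡⟨ sumFin-const (suc s) 1 ⟩
      suc s * 1                             ≡⟨ ℕ.*-identityʳ (suc s) ⟩
      suc s                                 ∎
      where
      open ≡-Reasoning
      J = toℕ (inject₁ j)
      defined : ∀ a → isJustℕ (δ D (zeros-state (inject₁ j)) a) ≡ 1
      defined a with _ , r , _ ← Descent⇒accepted (zeros J ∷ʳ a)
                                   (Descent-mono (Fin.inject₁ℕ< j) (Descent-zeros-∷ʳ J a))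
        rewrite δ-defined D (zeros J) a (zeros-state-run (inject₁ j)) r = refl

    transitions-lower : suc k * suc s ≤ transitions D
    transitions-lower = subst (_≤ transitions D)
      (trans (sumFin-cong (suc k) full-outdegree) (sumFin-const (suc k) (suc s)))
      (sumFin-∘-injective (Fin.inject₁-injective ∘ zeros-state-injective) (outdegree D))

lower-bound : ∀ σ n → 1 ≤ σ → 2 * σ ≤ n →
              Σ (Trie σ) λ T → size T ≡ n ×
                (∃ λ (D : DFA σ) → SmallestDFA D (Suffix T)) ×
                (∀ (D : DFA σ) → SmallestDFA D (Suffix T) → σ * n ≤ 2 * transitions D)
lower-bound (suc s) n _ 2σ≤n =
  comb k , trans (size-comb k) height+leaves≡n ,
  (descent-automaton k , descent-automaton-recognizes k , states-lower) ,
  λ D (D-recognizes , _) → begin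
    suc s * n               ≡⟨ cong (suc s *_) height+leaves≡n ⟨
    suc s * (suc k + suc s) ≤⟨ ℕ.*-monoʳ-≤ (suc s) (ℕ.+-monoʳ-≤ (suc k) σ≤height) ⟩
    suc s * (suc k + suc k) ≡⟨ double-product (suc k) (suc s) ⟩
    2 * (suc k * suc s)     ≤⟨ ℕ.*-monoʳ-≤ 2 (transitions-lower D D-recognizes) ⟩
    2 * transitions D       ∎
  where
  open Comb s
  open ℕ.≤-Reasoning

  -- n = 2σ + o; the comb of height k + 1 = σ + o has σ leaves.
  o = proj₁ (ℕ.m≤n⇒∃[o]m+o≡n 2σ≤n)
  k = s + o

  height+leaves≡n : suc k + suc s ≡ n
  height+leaves≡n = trans (regroup s o) (proj₂ (ℕ.m≤n⇒∃[o]m+o≡n 2σ≤n))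
    where
    regroup : ∀ s o → suc (s + o) + suc s ≡ 2 * suc s + o
    regroup = solve-∀

  σ≤height : suc s ≤ suc k
  σ≤height = s≤s (ℕ.m≤m+n s o)

  double-product : ∀ h σ → σ * (h + h) ≡ 2 * (h * σ)
  double-product = solve-∀

theorem7 :
    -- upper bound: O(σ n) transitions
    (∃ λ (c : ℕ) → ∀ (σ n : ℕ) (T : Trie σ) → size T ≡ n →
        ∀ (D : DFA σ) → SmallestDFA D (Suffix T) → transitions D ≤ c * σ * n)
    ×
    -- lower bound: Ω(σ n) transitions for some tries, for every σ with 1 ≤ σ ≤ n / k
    (∃ λ (c : ℕ) → ∃ λ (k : ℕ) → ∃ λ (n₀ : ℕ) →
        ∀ (σ n : ℕ) → 1 ≤ σ → k * σ ≤ n → n₀ ≤ n →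
        Σ (Trie σ) λ T → size T ≡ n ×
          (∃ λ (D : DFA σ) → SmallestDFA D (Suffix T)) ×
          (∀ (D : DFA σ) → SmallestDFA D (Suffix T) → σ * n ≤ c * transitions D))
theorem7 =
  (2 , λ { σ n T refl → upper-bound T }) ,
  (2 , 2 , 0 , λ σ n 1≤σ 2σ≤n _ → lower-bound σ n 1≤σ 2σ≤n)
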